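{- Let $D$ be an arc-weighted directed multigraph and let $c:E(D)\to[0,1]$ be an optimal (minimum weight) fractional triangle cover of $D$. Suppose there exists an arc $e$ with $c(e)\ge 5/9$. If $\tau_t(D\setminus e)\le 1.8\,\nu^*_t(D\setminus e)$, then $\tau_t(D)\le 1.8\,\nu^*_t(D)$.
   Context: A directed multigraph may contain parallel arcs and bigons. It is arc-weighted if each arc $e$ has a non-negative weight $w(e)$. A (directed) triangle is a triple of arcs $uv,vw,wu$ on three distinct vertices; $T(D)$ is the set of triangles. $D\setminus e$ is $D$ with arc $e$ removed. $\tau_t(D)$ is the minimum total weight of a set $F$ of arcs such that $D\setminus F$ has no directed triangle. A fractional triangle packing is $m:T(D)\to[0,\infty)$ with, for every arc $e$, $\sum_{T\ni e} m(T)\le w(e)$; its weight is $\sum_T m(T)$ and $\nu^*_t(D)$ is the maximum weight. A fractional triangle cover is $c:E(D)\to[0,1]$ with $c$ summing to at least $1$ over the three arcs of every triangle; its weight is $\sum_e w(e)c(e)$, and it is optimal if its weight is minimum.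
   Formalization: The arc weights, the fractional triangle covers (including the optimal cover $c$) and the fractional triangle packings all take rational values. -}

module Defs where

open import Data.Nat using (ℕ; zero; suc)
open import Data.Fin using (Fin; zero; suc; punchIn; _<_; _≟_)
open import Data.Bool using (Bool; true; false; if_then_else_)
open import Data.Integer using (+_)
open import Data.Rational using (ℚ; 0ℚ; 1ℚ; _+_; _*_; _≤_; _/_)
open import Data.Product using (Σ; _×_; _,_)
open import Relation.Binary.PropositionalEquality using (_≡_; _≢_)
open import Relation.Nullary using (¬_; Dec; yes; no)

ΣFin : (n : ℕ) → (Fin n → ℚ) → ℚ
ΣFin zero    f = 0ℚ
ΣFin (suc n) f = f zero + ΣFin n (λ i → f (suc i))

-- An arc-weighted directed multigraph on vertex set Fin n with arc set Fin m.
-- Parallel arcs / bigons are allowed (tail, head arbitrary functions).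
record Digraph (n m : ℕ) : Set where
  field
    tail   : Fin m → Fin n
    head   : Fin m → Fin n
    w      : Fin m → ℚ
    w-nonneg : ∀ e → 0ℚ ≤ w e
open Digraph public

removeArc : ∀ {n k} → Digraph n (suc k) → Fin (suc k) → Digraph n k
removeArc D e = record
  { tail = λ i → tail D (punchIn e i)
  ; head = λ i → head D (punchIn e i)
  ; w    = λ i → w D (punchIn e i)
  ; w-nonneg = λ i → w-nonneg D (punchIn e i) }

IsTriangle : ∀ {n m} → Digraph n m → Fin m → Fin m → Fin m → Set
IsTriangle D a b c =
  (head D a ≡ tail D b) × (head D b ≡ tail D c) × (head D c ≡ tail D a) ×
  (tail D a ≢ tail D b) × (tail D b ≢ tail D c) × (tail D a ≢ tail D c)

-- Each triangle {a,b,c} is represented exactly once, by the cyclic rotation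
-- whose first arc has the smallest index.
IsTriangleRep : ∀ {n m} → Digraph n m → Fin m → Fin m → Fin m → Set
IsTriangleRep D a b c = IsTriangle D a b c × (a < b) × (a < c)

weightSet : ∀ {n m} → Digraph n m → (Fin m → Bool) → ℚ
weightSet {m = m} D F = ΣFin m (λ e → if F e then w D e else 0ℚ)

HitsAllTriangles : ∀ {n m} → Digraph n m → (Fin m → Bool) → Set
HitsAllTriangles D F = ∀ a b c → IsTriangle D a b c →
  Σ (Fin _) λ e → (F e ≡ true) × ((e ≡ a) Data.Sum.⊎ ((e ≡ b) Data.Sum.⊎ (e ≡ c)))
  where import Data.Sum

IsTau : ∀ {n m} → Digraph n m → ℚ → Set
IsTau D t =
  (Σ (Fin _ → Bool) λ F → HitsAllTriangles D F × (weightSet D F ≡ t)) ×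
  (∀ F → HitsAllTriangles D F → t ≤ weightSet D F)

memb : ∀ {m} → Fin m → Fin m → Fin m → Fin m → Bool
memb e a b c with e ≟ a | e ≟ b | e ≟ c
... | no _ | no _ | no _ = false
... | _    | _    | _    = true

record Packing {n m : ℕ} (D : Digraph n m) : Set where
  field
    mass       : Fin m → Fin m → Fin m → ℚ
    mass-nonneg : ∀ a b c → 0ℚ ≤ mass a b c
    mass-supp  : ∀ a b c → ¬ IsTriangleRep D a b c → mass a b c ≡ 0ℚ
    capacity   : ∀ e → ΣFin m (λ a → ΣFin m (λ b → ΣFin m (λ c →
                   if memb e a b c then mass a b c else 0ℚ))) ≤ w D e
open Packing public

packingWeight : ∀ {n m} {D : Digraph n m} → Packing D → ℚ
packingWeight {m = m} P =
  ΣFin m (λ a → ΣFin m (λ b → ΣFin m (λ c → mass P a b c)))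

IsNuStar : ∀ {n m} → Digraph n m → ℚ → Set
IsNuStar D v =
  (Σ (Packing D) λ P → packingWeight P ≡ v) ×
  (∀ (P : Packing D) → packingWeight P ≤ v)

IsCover : ∀ {n m} → Digraph n m → (Fin m → ℚ) → Set
IsCover D c =
  (∀ e → (0ℚ ≤ c e) × (c e ≤ 1ℚ)) ×
  (∀ a b d → IsTriangle D a b d → 1ℚ ≤ c a + c b + c d)

coverWeight : ∀ {n m} → Digraph n m → (Fin m → ℚ) → ℚ
coverWeight {m = m} D c = ΣFin m (λ e → w D e * c e)

IsOptimalCover : ∀ {n m} → Digraph n m → (Fin m → ℚ) → Set
IsOptimalCover D c =
  IsCover D c × (∀ c' → IsCover D c' → coverWeight D c ≤ coverWeight D c')

fiveNinths : ℚ
fiveNinths = + 5 / 9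

onePointEight : ℚ
onePointEight = + 9 / 5

{-# OPTIONS --safe #-}
-- Deleting e costs at most w(e): τ_t(D) ≤ w(e) + τ_t(D \ e). The restriction c′ of c is a
-- fractional cover of D \ e, so ν*_t(D \ e) ≤ w(c′) by weak duality, and
-- w(c′) = w(c) - w(e) c(e) ≤ ν*_t(D) - (5/9) w(e) because, by LP duality, the optimal cover c
-- weighs at most ν*_t(D). Hence τ_t(D) ≤ w(e) + 1.8 (ν*_t(D) - (5/9) w(e)) = 1.8 ν*_t(D).
--
-- LP duality comes from Farkas' lemma, proved by Fourier–Motzkin elimination: either the
-- system  x ≥ 0,  x(T) ≥ 1 for every triangle T,  w·x ≤ ν*_t(D)  has a solution, and
-- truncating it at 1 gives a cover, or a nonnegative combination of these inequalities
-- reads 0 ≤ b with b < 0; the multipliers of the triangle inequalities in it, suitably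
-- scaled, then form a fractional packing heavier than ν*_t(D).
module Submission where

open import Defs
open import Algebra.Bundles using (CommutativeRing)
open import Data.Bool using (Bool; true; false; if_then_else_)
open import Data.Empty using (⊥; ⊥-elim)
open import Data.Fin as Fin using (Fin; zero; suc; punchIn; punchOut; _≟_)
import Data.Fin.Properties as Finₚ
open import Data.List using (List; []; _∷_; _++_; map; concatMap; cartesianProductWith; allFin)
open import Data.List.Membership.Propositional using (_∈_; lose)
open import Data.List.Membership.Propositional.Properties
  using (∈-allFin; ∈-concatMap⁺; ∈-++⁺ˡ; ∈-++⁺ʳ; ∈-map⁺; ∈-cartesianProductWith⁺)
open import Data.List.Relation.Unary.All as All using (All; []; _∷_; all?)
open import Data.List.Relation.Unary.All.Properties using (++⁻; map⁺; map⁻; ¬All⇒Any¬)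
open import Data.List.Relation.Unary.Any using (here; satisfied)
open import Data.Nat using (ℕ; zero; suc)
open import Data.Product using (Σ; Σ-syntax; ∃-syntax; _×_; _,_; proj₁; proj₂)
open import Data.Product.Properties using (≡-dec)
open import Data.Rational hiding (_≟_)
open import Data.Rational.Properties hiding (_≟_)
import Data.Rational.Properties as ℚ
open import Data.Sum as Sum using (_⊎_; inj₁; inj₂)
open import Data.Vec.Functional as Vec using (Vector; insertAt)
open import Data.Vec.Functional.Properties using (insertAt-lookup; insertAt-punchIn)
open import Function using (_∘_)
open import Relation.Binary.Bundles using (DecTotalOrder)
open import Relation.Binary.Definitions using (tri<; tri≈; tri>)
open import Relation.Binary.PropositionalEquality
open import Relation.Nullary using (Dec; yes; no; ¬_; does; contradiction)
open import Relation.Nullary.Decidable using (dec⇒maybe; dec-true; dec-false; _×-dec_; ¬?)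
open import Tactic.RingSolver using (solve-∀)
open import Tactic.RingSolver.Core.AlmostCommutativeRing
  using (AlmostCommutativeRing; fromCommutativeRing)

open import Algebra.Properties.Semiring.Sum (CommutativeRing.semiring +-*-commutativeRing)
  using (sum; sum-cong-≗; sum-replicate-zero; sum-remove; ∑-distrib-+; ∑-comm; *-distribˡ-sum)
open import Data.List.Extrema (DecTotalOrder.totalOrder ℚ.≤-decTotalOrder)
  using (min; max; min≤xs; xs≤max; max≤v⁺)

ℚ-ring : AlmostCommutativeRing _ _
ℚ-ring = fromCommutativeRing +-*-commutativeRing (dec⇒maybe ∘ (0ℚ ℚ.≟_))

inv⁺ : (q : ℚ) → 0ℚ < q → ℚ
inv⁺ q 0<q = (1/ q) {{>-nonZero 0<q}}

inv⁺-pos : ∀ {q} (0<q : 0ℚ < q) → 0ℚ < inv⁺ q 0<q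
inv⁺-pos {q} 0<q = positive⁻¹ _ {{1/pos⇒pos q {{positive 0<q}}}}

inv⁺-inverseˡ : ∀ {q} (0<q : 0ℚ < q) → inv⁺ q 0<q * q ≡ 1ℚ
inv⁺-inverseˡ {q} 0<q = *-inverseˡ q {{>-nonZero 0<q}}

*-nonneg : ∀ {p q} → 0ℚ ≤ p → 0ℚ ≤ q → 0ℚ ≤ p * q
*-nonneg {p} {q} p≥0 q≥0 =
  nonNegative⁻¹ _ {{nonNeg*nonNeg⇒nonNeg p {{nonNegative p≥0}} q {{nonNegative q≥0}}}}

*-pos : ∀ {p q} → 0ℚ < p → 0ℚ < q → 0ℚ < p * q
*-pos {p} {q} p>0 q>0 = positive⁻¹ _ {{pos*pos⇒pos p {{positive p>0}} q {{positive q>0}}}}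

*-monoˡ-≤-≥0 : ∀ {r p q} → 0ℚ ≤ r → p ≤ q → r * p ≤ r * q
*-monoˡ-≤-≥0 {r} r≥0 = *-monoˡ-≤-nonNeg r {{nonNegative r≥0}}

*-monoʳ-≤-≥0 : ∀ {r p q} → 0ℚ ≤ r → p ≤ q → p * r ≤ q * r
*-monoʳ-≤-≥0 {r} r≥0 = *-monoʳ-≤-nonNeg r {{nonNegative r≥0}}

<⇒≱ : ∀ {p q} → p < q → ¬ q ≤ p
<⇒≱ p<q q≤p = <-irrefl refl (<-≤-trans p<q q≤p)

p<p+q : ∀ p {q} → 0ℚ < q → p < p + q
p<p+q p {q} 0<q = subst (_< p + q) (+-identityʳ p) (+-monoʳ-< p 0<q)

v<Λ⁻¹*[Λ*v-b] : ∀ v {Λ b} (0<Λ : 0ℚ < Λ) → b < 0ℚ → v < inv⁺ Λ 0<Λ * (Λ * v - b)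
v<Λ⁻¹*[Λ*v-b] v {Λ} {b} 0<Λ b<0 = begin-strict
  v                    <⟨ p<p+q v (*-pos (inv⁺-pos 0<Λ) (neg-antimono-< b<0)) ⟩
  v + t * - b          ≡⟨ cong (_+ t * - b) (sym (trans (cong (_* v) tΛ≡1) (*-identityˡ v))) ⟩
  t * Λ * v + t * - b  ≡⟨ sym (distrib t Λ v b) ⟩
  t * (Λ * v - b)      ∎
  where
  open ≤-Reasoning
  t = inv⁺ Λ 0<Λ
  tΛ≡1 : t * Λ ≡ 1ℚ
  tΛ≡1 = inv⁺-inverseˡ 0<Λ
  distrib : ∀ t Λ v b → t * (Λ * v - b) ≡ t * Λ * v + t * - b
  distrib = solve-∀ ℚ-ring

v<[v+1]*[-b]⁻¹*[0*v-b] : ∀ v {b} (b<0 : b < 0ℚ) →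
                         v < (v + 1ℚ) * inv⁺ (- b) (neg-antimono-< b<0) * (0ℚ * v - b)
v<[v+1]*[-b]⁻¹*[0*v-b] v {b} b<0 = begin-strict
  v                           <⟨ p<p+q v (positive⁻¹ 1ℚ) ⟩
  v + 1ℚ                      ≡⟨ sym (*-identityʳ (v + 1ℚ)) ⟩
  (v + 1ℚ) * 1ℚ               ≡⟨ cong ((v + 1ℚ) *_) (sym (inv⁺-inverseˡ (neg-antimono-< b<0))) ⟩
  (v + 1ℚ) * (i * - b)        ≡⟨ regroup (v + 1ℚ) i v b ⟩
  (v + 1ℚ) * i * (0ℚ * v - b) ∎
  where
  open ≤-Reasoning
  i = inv⁺ (- b) (neg-antimono-< b<0)
  regroup : ∀ p i v b → p * (i * - b) ≡ p * i * (0ℚ * v - b)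
  regroup = solve-∀ ℚ-ring

p≤q-r⇒p+r≤q : ∀ {p q r} → p ≤ q - r → p + r ≤ q
p≤q-r⇒p+r≤q {p} {q} {r} p≤q-r = subst (p + r ≤_) (cancel q r) (+-monoˡ-≤ r p≤q-r)
  where
  cancel : ∀ q r → q - r + r ≡ q
  cancel = solve-∀ ℚ-ring

r-q≤p⇒-p+r≤q : ∀ {p q r} → r - q ≤ p → - p + r ≤ q
r-q≤p⇒-p+r≤q {p} {q} {r} r-q≤p =
  subst (- p + r ≤_) (cancel q r) (+-monoˡ-≤ r (neg-antimono-≤ r-q≤p))
  where
  cancel : ∀ q r → - (r - q) + r ≡ q
  cancel = solve-∀ ℚ-ring

p+q≤r+s⇒q-s≤r-p : ∀ {p q r s} → p + q ≤ r + s → q - s ≤ r - p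
p+q≤r+s⇒q-s≤r-p {p} {q} {r} {s} p+q≤r+s =
  subst₂ _≤_ (cancelˡ p q s) (cancelʳ p r s) (+-monoˡ-≤ (- p - s) p+q≤r+s)
  where
  cancelˡ : ∀ p q s → p + q + (- p - s) ≡ q - s
  cancelˡ = solve-∀ ℚ-ring
  cancelʳ : ∀ p r s → r + s + (- p - s) ≡ r - p
  cancelʳ = solve-∀ ℚ-ring

-1*p≤-q⇒q≤p : ∀ {p q} → - 1ℚ * p ≤ - q → q ≤ p
-1*p≤-q⇒q≤p {p} {q} -p≤-q =
  subst₂ _≤_ (cancelˡ p q) (cancelʳ p q) (+-monoˡ-≤ (p + q) -p≤-q)
  where
  cancelˡ : ∀ p q → - 1ℚ * p + (p + q) ≡ q
  cancelˡ = solve-∀ ℚ-ring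
  cancelʳ : ∀ p q → - q + (p + q) ≡ p
  cancelʳ = solve-∀ ℚ-ring

+-rotate : ∀ p q r → p + q + r ≡ r + p + q
+-rotate = solve-∀ ℚ-ring

⊓1-nonneg : ∀ {s} → 0ℚ ≤ s → 0ℚ ≤ s ⊓ 1ℚ
⊓1-nonneg s≥0 = ⊓-glb s≥0 (<⇒≤ (positive⁻¹ 1ℚ))

⊓1-saturated : ∀ {s} → 1ℚ ≤ s → 1ℚ ≤ s ⊓ 1ℚ
⊓1-saturated 1≤s = ≤-reflexive (sym (p≥q⇒p⊓q≡q 1≤s))

⊓1-sum : ∀ {p q r} → 0ℚ ≤ p → 0ℚ ≤ q → 0ℚ ≤ r → 1ℚ ≤ p + q + r →
         1ℚ ≤ p ⊓ 1ℚ + q ⊓ 1ℚ + r ⊓ 1ℚ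
⊓1-sum {p} {q} {r} p≥0 q≥0 r≥0 1≤p+q+r with ≤-total 1ℚ p | ≤-total 1ℚ q | ≤-total 1ℚ r
... | inj₁ 1≤p | _        | _        =
  +-mono-≤ (+-mono-≤ (⊓1-saturated 1≤p) (⊓1-nonneg q≥0)) (⊓1-nonneg r≥0)
... | inj₂ _   | inj₁ 1≤q | _        =
  +-mono-≤ (+-mono-≤ (⊓1-nonneg p≥0) (⊓1-saturated 1≤q)) (⊓1-nonneg r≥0)
... | inj₂ _   | inj₂ _   | inj₁ 1≤r =
  +-mono-≤ (+-mono-≤ (⊓1-nonneg p≥0) (⊓1-nonneg q≥0)) (⊓1-saturated 1≤r)
... | inj₂ p≤1 | inj₂ q≤1 | inj₂ r≤1 =
  subst (1ℚ ≤_)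
        (sym (cong₂ _+_ (cong₂ _+_ (p≤q⇒p⊓q≡p p≤1) (p≤q⇒p⊓q≡p q≤1)) (p≤q⇒p⊓q≡p r≤1)))
        1≤p+q+r

interpolate : (ls us : List ℚ) → All (λ u → All (_≤ u) ls) us →
              ∃[ x ] All (_≤ x) ls × All (x ≤_) us
interpolate ls us ls≤us =
  max (min 0ℚ us) ls , xs≤max _ ls ,
  All.zipWith (λ (m≤u , ls≤u) → max≤v⁺ m≤u ls≤u) (min≤xs 0ℚ us , ls≤us)

sum-mono-≤ : ∀ {n} {f g : Vector ℚ n} → (∀ i → f i ≤ g i) → sum f ≤ sum g
sum-mono-≤ {zero}  f≤g = ≤-refl
sum-mono-≤ {suc n} f≤g = +-mono-≤ (f≤g zero) (sum-mono-≤ (f≤g ∘ suc))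

sum-zero : ∀ {n} {f : Vector ℚ n} → (∀ i → f i ≡ 0ℚ) → sum f ≡ 0ℚ
sum-zero {n} f≡0 = trans (sum-cong-≗ f≡0) (sum-replicate-zero n)

sum-nonneg : ∀ {n} {f : Vector ℚ n} → (∀ i → 0ℚ ≤ f i) → 0ℚ ≤ sum f
sum-nonneg {n} {f} f≥0 =
  subst (_≤ sum f) (sum-zero {n} {λ _ → 0ℚ} (λ _ → refl)) (sum-mono-≤ f≥0)

sum-point : ∀ {n} (i : Fin n) {f : Vector ℚ n} → (∀ j → j ≢ i → f j ≡ 0ℚ) → sum f ≡ f i
sum-point {suc _} i {f} f≡0 = begin
  sum f                      ≡⟨ sum-remove {i = i} f ⟩
  f i + sum (f ∘ punchIn i)
    ≡⟨ cong (f i +_) (sum-zero λ j → f≡0 (punchIn i j) (Finₚ.punchInᵢ≢i i j)) ⟩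
  f i + 0ℚ                   ≡⟨ +-identityʳ (f i) ⟩
  f i                        ∎
  where open ≡-Reasoning

ΣFin≡sum : ∀ n (f : Vector ℚ n) → ΣFin n f ≡ sum f
ΣFin≡sum zero    f = refl
ΣFin≡sum (suc n) f = cong (f zero +_) (ΣFin≡sum n (f ∘ suc))

ΣFin-cong : ∀ n {f g : Vector ℚ n} → (∀ i → f i ≡ g i) → ΣFin n f ≡ ΣFin n g
ΣFin-cong n {f} {g} f≡g = trans (ΣFin≡sum n f) (trans (sum-cong-≗ f≡g) (sym (ΣFin≡sum n g)))

ΣFin-punchIn : ∀ k (i : Fin (suc k)) (f : Vector ℚ (suc k)) →
               ΣFin (suc k) f ≡ f i + ΣFin k (f ∘ punchIn i)
ΣFin-punchIn k i f = begin
  ΣFin (suc k) f               ≡⟨ ΣFin≡sum (suc k) f ⟩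
  sum f                        ≡⟨ sum-remove {i = i} f ⟩
  f i + sum (f ∘ punchIn i)    ≡⟨ cong (f i +_) (sym (ΣFin≡sum k (f ∘ punchIn i))) ⟩
  f i + ΣFin k (f ∘ punchIn i) ∎
  where open ≡-Reasoning

when : Bool → ℚ → ℚ
when b y = if b then y else 0ℚ

when-zero : ∀ b → when b 0ℚ ≡ 0ℚ
when-zero true  = refl
when-zero false = refl

when-+ : ∀ b y z → when b (y + z) ≡ when b y + when b z
when-+ true  y z = refl
when-+ false y z = refl

when-*ˡ : ∀ b q y → when b (q * y) ≡ q * when b y
when-*ˡ true  q y = refl
when-*ˡ false q y = sym (*-zeroʳ q)

when-*ʳ : ∀ b y q → when b y * q ≡ when b (y * q)
when-*ʳ true  y q = refl
when-*ʳ false y q = *-zeroˡ q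

when-nonneg : ∀ b {y} → 0ℚ ≤ y → 0ℚ ≤ when b y
when-nonneg true  y≥0 = y≥0
when-nonneg false _   = ≤-refl

when-nonpos : ∀ b {y} → y ≤ 0ℚ → when b y ≤ 0ℚ
when-nonpos true  y≤0 = y≤0
when-nonpos false _   = ≤-refl

sum-when-≟ : ∀ {m} (i : Fin m) (f : Vector ℚ m) → sum (λ j → when (does (j ≟ i)) (f j)) ≡ f i
sum-when-≟ i f = trans (sum-point i off) (cong (λ b → when b (f i)) (dec-true (i ≟ i) refl))
  where
  off : ∀ j → j ≢ i → when (does (j ≟ i)) (f j) ≡ 0ℚ
  off j j≢i = cong (λ b → when b (f j)) (dec-false (j ≟ i) j≢i)

memb-split : ∀ {m} {a b c : Fin m} → a ≢ b → b ≢ c → a ≢ c → ∀ j y →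
  when (memb j a b c) y ≡ when (does (j ≟ a)) y + when (does (j ≟ b)) y + when (does (j ≟ c)) y
memb-split {a = a} {b} {c} a≢b b≢c a≢c j y with j ≟ a | j ≟ b | j ≟ c
... | yes refl | yes refl | _        = contradiction refl a≢b
... | yes refl | _        | yes refl = contradiction refl a≢c
... | _        | yes refl | yes refl = contradiction refl b≢c
... | yes _    | no _     | no _     = sym (trans (+-identityʳ _) (+-identityʳ y))
... | no _     | yes _    | no _     = sym (trans (+-identityʳ _) (+-identityˡ y))
... | no _     | no _     | yes _    = sym (+-identityˡ y)
... | no _     | no _     | no _     = refl

sum-memb : ∀ {m} {a b c : Fin m} → a ≢ b → b ≢ c → a ≢ c → (f : Vector ℚ m) →
           sum (λ j → when (memb j a b c) (f j)) ≡ f a + f b + f c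
sum-memb {a = a} {b} {c} a≢b b≢c a≢c f = begin
  sum (λ j → when (memb j a b c) (f j))
    ≡⟨ sum-cong-≗ (λ j → memb-split a≢b b≢c a≢c j (f j)) ⟩
  sum (λ j → δ a j + δ b j + δ c j)
    ≡⟨ ∑-distrib-+ (λ j → δ a j + δ b j) (δ c) ⟩
  sum (λ j → δ a j + δ b j) + sum (δ c)
    ≡⟨ cong (_+ sum (δ c)) (∑-distrib-+ (δ a) (δ b)) ⟩
  sum (δ a) + sum (δ b) + sum (δ c)
    ≡⟨ cong₂ _+_ (cong₂ _+_ (sum-when-≟ a f) (sum-when-≟ b f)) (sum-when-≟ c f) ⟩
  f a + f b + f c ∎
  where
  open ≡-Reasoning
  δ : Fin _ → Vector ℚ _
  δ i j = when (does (j ≟ i)) (f j)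

Weights : ℕ → Set
Weights m = Fin m → Fin m → Fin m → ℚ

Σ³ : ∀ {m} → Weights m → ℚ
Σ³ F = sum λ a → sum λ b → sum λ c → F a b c

ΣFin³≡Σ³ : ∀ m (F : Weights m) →
           ΣFin m (λ a → ΣFin m (λ b → ΣFin m (λ c → F a b c))) ≡ Σ³ F
ΣFin³≡Σ³ m F = trans (ΣFin≡sum m _) (sum-cong-≗ λ a →
               trans (ΣFin≡sum m _) (sum-cong-≗ λ b → ΣFin≡sum m (F a b)))

module _ {m : ℕ} where

  Σ³-cong : {F G : Weights m} → (∀ a b c → F a b c ≡ G a b c) → Σ³ F ≡ Σ³ G
  Σ³-cong F≡G = sum-cong-≗ λ a → sum-cong-≗ λ b → sum-cong-≗ (F≡G a b)

  Σ³-mono-≤ : {F G : Weights m} → (∀ a b c → F a b c ≤ G a b c) → Σ³ F ≤ Σ³ G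
  Σ³-mono-≤ F≤G = sum-mono-≤ λ a → sum-mono-≤ λ b → sum-mono-≤ (F≤G a b)

  Σ³-zero : {F : Weights m} → (∀ a b c → F a b c ≡ 0ℚ) → Σ³ F ≡ 0ℚ
  Σ³-zero F≡0 = sum-zero λ a → sum-zero λ b → sum-zero (F≡0 a b)

  Σ³-0 : Σ³ {m} (λ _ _ _ → 0ℚ) ≡ 0ℚ
  Σ³-0 = Σ³-zero (λ _ _ _ → refl)

  Σ³-distrib-+ : (F G : Weights m) → Σ³ (λ a b c → F a b c + G a b c) ≡ Σ³ F + Σ³ G
  Σ³-distrib-+ F G = begin
    Σ³ (λ a b c → F a b c + G a b c)
      ≡⟨ sum-cong-≗ (λ a → sum-cong-≗ λ b → ∑-distrib-+ (F a b) (G a b)) ⟩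
    sum (λ a → sum λ b → sum (F a b) + sum (G a b))
      ≡⟨ sum-cong-≗ (λ a → ∑-distrib-+ (λ b → sum (F a b)) (λ b → sum (G a b))) ⟩
    sum (λ a → sum (λ b → sum (F a b)) + sum (λ b → sum (G a b)))
      ≡⟨ ∑-distrib-+ (λ a → sum λ b → sum (F a b)) (λ a → sum λ b → sum (G a b)) ⟩
    Σ³ F + Σ³ G ∎
    where open ≡-Reasoning

  *-distribˡ-Σ³ : ∀ q (F : Weights m) → q * Σ³ F ≡ Σ³ (λ a b c → q * F a b c)
  *-distribˡ-Σ³ q F =
    trans (*-distribˡ-sum q (λ a → sum λ b → sum (F a b))) (sum-cong-≗ λ a →
    trans (*-distribˡ-sum q (λ b → sum (F a b))) (sum-cong-≗ λ b → *-distribˡ-sum q (F a b)))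

  Σ³-comm-sum : ∀ {k} (G : Fin m → Fin m → Fin m → Vector ℚ k) →
                Σ³ (λ a b c → sum (G a b c)) ≡ sum (λ e → Σ³ (λ a b c → G a b c e))
  Σ³-comm-sum G =
    trans (sum-cong-≗ λ a → trans (sum-cong-≗ λ b → ∑-comm (G a b))
                                  (∑-comm λ b e → sum λ c → G a b c e))
          (∑-comm λ a e → sum λ b → sum λ c → G a b c e)

  Σ³-point : ∀ a b c {F : Weights m} →
             (∀ a′ b′ c′ → (a′ , b′ , c′) ≢ (a , b , c) → F a′ b′ c′ ≡ 0ℚ) →
             Σ³ F ≡ F a b c
  Σ³-point a b c {F} off = begin
    Σ³ F
      ≡⟨ sum-point a (λ a′ a′≢a → sum-zero λ b′ → sum-zero λ c′ →
                        off a′ b′ c′ (a′≢a ∘ cong proj₁)) ⟩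
    sum (λ b′ → sum (F a b′))
      ≡⟨ sum-point b (λ b′ b′≢b → sum-zero λ c′ →
                        off a b′ c′ (b′≢b ∘ cong (proj₁ ∘ proj₂))) ⟩
    sum (F a b)
      ≡⟨ sum-point c (λ c′ c′≢c → off a b c′ (c′≢c ∘ cong (proj₂ ∘ proj₂))) ⟩
    F a b c ∎
    where open ≡-Reasoning

  load : Weights m → Fin m → ℚ
  load Y e = Σ³ (λ a b c → when (memb e a b c) (Y a b c))

  load-+ : ∀ (Y Z : Weights m) e → load (λ a b c → Y a b c + Z a b c) e ≡ load Y e + load Z e
  load-+ Y Z e = trans (Σ³-cong (λ a b c → when-+ (memb e a b c) (Y a b c) (Z a b c)))
                       (Σ³-distrib-+ (λ a b c → when (memb e a b c) (Y a b c))
                                     (λ a b c → when (memb e a b c) (Z a b c)))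

  load-scale : ∀ t (Y : Weights m) e → load (λ a b c → t * Y a b c) e ≡ t * load Y e
  load-scale t Y e = trans (Σ³-cong (λ a b c → when-*ˡ (memb e a b c) t (Y a b c)))
                           (sym (*-distribˡ-Σ³ t (λ a b c → when (memb e a b c) (Y a b c))))

  load-zero : ∀ (e : Fin m) → load (λ _ _ _ → 0ℚ) e ≡ 0ℚ
  load-zero e = Σ³-zero {F = λ a b c → when (memb e a b c) 0ℚ} (λ a b c → when-zero (memb e a b c))

  _≟³_ : (x y : Fin m × Fin m × Fin m) → Dec (x ≡ y)
  _≟³_ = ≡-dec _≟_ (≡-dec _≟_ _≟_)

  point : Fin m → Fin m → Fin m → Weights m
  point a b c a′ b′ c′ = when (does ((a′ , b′ , c′) ≟³ (a , b , c))) 1ℚ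

  point-off : ∀ {a b c a′ b′ c′} → (a′ , b′ , c′) ≢ (a , b , c) →
              point a b c a′ b′ c′ ≡ 0ℚ
  point-off {a} {b} {c} {a′} {b′} {c′} ≢abc =
    cong (λ s → when s 1ℚ) (dec-false ((a′ , b′ , c′) ≟³ (a , b , c)) ≢abc)

  point-self : ∀ a b c → point a b c a b c ≡ 1ℚ
  point-self a b c = cong (λ s → when s 1ℚ) (dec-true ((a , b , c) ≟³ (a , b , c)) refl)

  Σ³-point-self : ∀ a b c → Σ³ (point a b c) ≡ 1ℚ
  Σ³-point-self a b c = trans (Σ³-point a b c (λ _ _ _ → point-off)) (point-self a b c)

  load-point : ∀ a b c e → load (point a b c) e ≡ when (memb e a b c) 1ℚ
  load-point a b c e =
    trans (Σ³-point a b c λ a′ b′ c′ ≢abc →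
             trans (cong (when (memb e a′ b′ c′)) (point-off ≢abc)) (when-zero (memb e a′ b′ c′)))
          (cong (when (memb e a b c)) (point-self a b c))

-- Farkas' lemma by Fourier–Motzkin elimination

record Ineq (N : ℕ) : Set where
  field
    coeff : Vector ℚ N
    bound : ℚ

open Ineq

dot : ∀ {N} → Vector ℚ N → Vector ℚ N → ℚ
dot f x = sum (λ j → f j * x j)

_⊨_ : ∀ {N} → Vector ℚ N → Ineq N → Set
x ⊨ r = dot (coeff r) x ≤ bound r

dot-+ : ∀ {N} (f g x : Vector ℚ N) → dot (λ j → f j + g j) x ≡ dot f x + dot g x
dot-+ f g x = trans (sum-cong-≗ λ j → *-distribʳ-+ (x j) (f j) (g j))
                    (∑-distrib-+ (λ j → f j * x j) (λ j → g j * x j))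

dot-* : ∀ {N} q (f x : Vector ℚ N) → dot (λ j → q * f j) x ≡ q * dot f x
dot-* q f x = trans (sum-cong-≗ λ j → *-assoc q (f j) (x j))
                    (sym (*-distribˡ-sum q (λ j → f j * x j)))

dot-when : ∀ {N} (P : Fin N → Bool) q (x : Vector ℚ N) →
           dot (λ j → when (P j) q) x ≡ sum (λ j → when (P j) (q * x j))
dot-when P q x = sum-cong-≗ λ j → when-*ʳ (P j) q (x j)

_⊕ᴵ_ : ∀ {N} → Ineq N → Ineq N → Ineq N
r ⊕ᴵ s = record { coeff = λ j → coeff r j + coeff s j ; bound = bound r + bound s }

_·ᴵ_ : ∀ {N} → ℚ → Ineq N → Ineq N
q ·ᴵ r = record { coeff = λ j → q * coeff r j ; bound = q * bound r }

·ᴵ-cancel : ∀ {N q} (x : Vector ℚ N) (r : Ineq N) → 0ℚ < q → x ⊨ (q ·ᴵ r) → x ⊨ r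
·ᴵ-cancel {q = q} x r 0<q x⊨qr =
  *-cancelˡ-≤-pos q {{positive 0<q}} (subst (_≤ q * bound r) (dot-* q (coeff r) x) x⊨qr)

-- Kept as syntax trees rather than as multiplier vectors: the dual solution hidden in a
-- refutation is read off by recursion on the tree.
data Combination {A : Set} {N : ℕ} (row : A → Ineq N) : Set where
  axiom : A → Combination row
  _⊕_   : Combination row → Combination row → Combination row
  scale : (q : ℚ) → 0ℚ ≤ q → Combination row → Combination row

module _ {A : Set} {N : ℕ} {row : A → Ineq N} where

  derived : Combination row → Ineq N
  derived (axiom a)     = row a
  derived (d ⊕ e)       = derived d ⊕ᴵ derived e
  derived (scale q _ d) = q ·ᴵ derived d

Refutation : ∀ {A : Set} {N} → (A → Ineq N) → Set
Refutation row =
  Σ[ d ∈ Combination row ] (∀ j → coeff (derived d) j ≡ 0ℚ) × bound (derived d) < 0ℚ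

module Elimination {A : Set} {N : ℕ} (row : A → Ineq (suc N)) where

  lead : Combination row → ℚ
  lead d = coeff (derived d) zero

  rest : Combination row → Ineq N
  rest d = record { coeff = coeff (derived d) ∘ suc ; bound = bound (derived d) }

  WithLead : ℚ → Set
  WithLead q = Σ[ d ∈ Combination row ] lead d ≡ q

  row′ : WithLead 0ℚ → Ineq N
  row′ (d , _) = rest d

  _⊨ᶜ_ : ∀ {q} → Vector ℚ (suc N) → WithLead q → Set
  y ⊨ᶜ u = y ⊨ derived (proj₁ u)

  normalise⁺ : (a : A) → 0ℚ < lead (axiom a) → WithLead 1ℚ
  normalise⁺ a 0<a₀ =
    scale (inv⁺ _ 0<a₀) (<⇒≤ (inv⁺-pos 0<a₀)) (axiom a) , inv⁺-inverseˡ 0<a₀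

  normalise⁻ : (a : A) → lead (axiom a) < 0ℚ → WithLead (- 1ℚ)
  normalise⁻ a a₀<0 =
    scale q (<⇒≤ (inv⁺-pos 0<-a₀)) (axiom a) , trans (*≡-*- q a₀) (cong -_ (inv⁺-inverseˡ 0<-a₀))
    where
    a₀ = lead (axiom a)
    0<-a₀ = neg-antimono-< a₀<0
    q = inv⁺ (- a₀) 0<-a₀
    *≡-*- : ∀ p q → p * q ≡ - (p * - q)
    *≡-*- = solve-∀ ℚ-ring

  -- After normalisation a row bounds x₀ from above (coefficient 1), from below (-1),
  -- or not at all (0).
  record Split : Set where
    field
      uppers : List (WithLead 1ℚ)
      lowers : List (WithLead (- 1ℚ))
      frees  : List (WithLead 0ℚ)
  open Split

  split : List A → Split
  split [] = record { uppers = [] ; lowers = [] ; frees = [] }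
  split (a ∷ as) with <-cmp 0ℚ (lead (axiom a))
  ... | tri< 0<a₀ _ _ = record (split as) { uppers = normalise⁺ a 0<a₀ ∷ uppers (split as) }
  ... | tri≈ _ 0≡a₀ _ = record (split as) { frees = (axiom a , sym 0≡a₀) ∷ frees (split as) }
  ... | tri> _ _ a₀<0 = record (split as) { lowers = normalise⁻ a a₀<0 ∷ lowers (split as) }

  split-sound : ∀ y L → All (y ⊨ᶜ_) (uppers (split L)) → All (y ⊨ᶜ_) (lowers (split L)) →
                All (y ⊨ᶜ_) (frees (split L)) → All (λ a → y ⊨ row a) L
  split-sound y [] _ _ _ = []
  split-sound y (a ∷ as) us ls fs with <-cmp 0ℚ (lead (axiom a))
  ... | tri< 0<a₀ _ _ =
    ·ᴵ-cancel y (row a) (inv⁺-pos 0<a₀) (All.head us) ∷ split-sound y as (All.tail us) ls fs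
  ... | tri≈ _ _ _ =
    All.head fs ∷ split-sound y as us ls (All.tail fs)
  ... | tri> _ _ a₀<0 =
    ·ᴵ-cancel y (row a) (inv⁺-pos (neg-antimono-< a₀<0)) (All.head ls) ∷
    split-sound y as us (All.tail ls) fs

  combine : WithLead 1ℚ → WithLead (- 1ℚ) → WithLead 0ℚ
  combine (d , d₀≡1) (e , e₀≡-1) = d ⊕ e , trans (cong₂ _+_ d₀≡1 e₀≡-1) (+-inverseʳ 1ℚ)

  eliminate : List A → List (WithLead 0ℚ)
  eliminate L = frees (split L) ++ cartesianProductWith combine (uppers (split L)) (lowers (split L))

  module _ (x : Vector ℚ N) where

    upper : WithLead 1ℚ → ℚ
    upper (d , _) = bound (derived d) - dot (coeff (rest d)) x

    lower : WithLead (- 1ℚ) → ℚ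
    lower (d , _) = dot (coeff (rest d)) x - bound (derived d)

    lower≤upper : ∀ u l → x ⊨ row′ (combine u l) → lower l ≤ upper u
    lower≤upper (d , _) (e , _) x⊨d⊕e =
      p+q≤r+s⇒q-s≤r-p {dot (coeff (rest d)) x} {dot (coeff (rest e)) x}
                      {bound (derived d)} {bound (derived e)}
        (subst (_≤ bound (derived d) + bound (derived e)) (dot-+ (coeff (rest d)) (coeff (rest e)) x) x⊨d⊕e)

    upper-sat : ∀ {x₀} u → x₀ ≤ upper u → (x₀ Vec.∷ x) ⊨ᶜ u
    upper-sat {x₀} (d , d₀≡1) x₀≤u = begin
      lead d * x₀ + R   ≡⟨ cong (λ q → q * x₀ + R) d₀≡1 ⟩
      1ℚ * x₀ + R       ≡⟨ cong (_+ R) (*-identityˡ x₀) ⟩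
      x₀ + R            ≤⟨ p≤q-r⇒p+r≤q x₀≤u ⟩
      bound (derived d) ∎
      where
      open ≤-Reasoning
      R = dot (coeff (rest d)) x

    lower-sat : ∀ {x₀} l → lower l ≤ x₀ → (x₀ Vec.∷ x) ⊨ᶜ l
    lower-sat {x₀} (d , d₀≡-1) l≤x₀ = begin
      lead d * x₀ + R   ≡⟨ cong (λ q → q * x₀ + R) d₀≡-1 ⟩
      - 1ℚ * x₀ + R     ≡⟨ cong (_+ R) (sym (neg-distribˡ-* 1ℚ x₀)) ⟩
      - (1ℚ * x₀) + R   ≡⟨ cong (λ z → - z + R) (*-identityˡ x₀) ⟩
      - x₀ + R          ≤⟨ r-q≤p⇒-p+r≤q l≤x₀ ⟩
      bound (derived d) ∎
      where
      open ≤-Reasoning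
      R = dot (coeff (rest d)) x

    free-sat : ∀ {x₀} (f : WithLead 0ℚ) → x ⊨ row′ f → (x₀ Vec.∷ x) ⊨ᶜ f
    free-sat {x₀} (d , d₀≡0) x⊨f = begin
      lead d * x₀ + R   ≡⟨ cong (λ q → q * x₀ + R) d₀≡0 ⟩
      0ℚ * x₀ + R       ≡⟨ cong (_+ R) (*-zeroˡ x₀) ⟩
      0ℚ + R            ≡⟨ +-identityˡ R ⟩
      R                 ≤⟨ x⊨f ⟩
      bound (derived d) ∎
      where
      open ≤-Reasoning
      R = dot (coeff (rest d)) x

  extend : ∀ L → ∃[ x ] All (λ f → x ⊨ row′ f) (eliminate L) →
                 ∃[ y ] All (λ a → y ⊨ row a) L
  extend L (x , sat) =
    x₀ Vec.∷ x ,
    split-sound (x₀ Vec.∷ x) L (All.map (λ {u} → upper-sat x {x₀} u) (map⁻ x₀≤uppers))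
                               (All.map (λ {l} → lower-sat x {x₀} l) (map⁻ lowers≤x₀))
                               (All.map (λ {f} → free-sat x {x₀} f) (proj₁ (++⁻ (frees S) sat)))
    where
    S = split L
    lowers≤uppers : All (λ u → All (λ l → lower x l ≤ upper x u) (lowers S)) (uppers S)
    lowers≤uppers = All.tabulate λ {u} u∈ → All.tabulate λ {l} l∈ → lower≤upper x u l
      (All.lookup (proj₂ (++⁻ (frees S) sat)) (∈-cartesianProductWith⁺ combine u∈ l∈))
    between = interpolate (map (lower x) (lowers S)) (map (upper x) (uppers S))
                          (map⁺ (All.map map⁺ lowers≤uppers))
    x₀ = proj₁ between
    lowers≤x₀ : All (_≤ x₀) (map (lower x) (lowers S))
    lowers≤x₀ = proj₁ (proj₂ between)
    x₀≤uppers : All (x₀ ≤_) (map (upper x) (uppers S))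
    x₀≤uppers = proj₂ (proj₂ between)

  flatten : Combination row′ → Combination row
  flatten (axiom (d , _))  = d
  flatten (d ⊕ e)          = flatten d ⊕ flatten e
  flatten (scale q q≥0 d)  = scale q q≥0 (flatten d)

  flatten-lead : ∀ d → lead (flatten d) ≡ 0ℚ
  flatten-lead (axiom (_ , d₀≡0)) = d₀≡0
  flatten-lead (d ⊕ e)            = cong₂ _+_ (flatten-lead d) (flatten-lead e)
  flatten-lead (scale q _ d)      = trans (cong (q *_) (flatten-lead d)) (*-zeroʳ q)

  flatten-rest : ∀ d j → coeff (rest (flatten d)) j ≡ coeff (derived d) j
  flatten-rest (axiom _)     j = refl
  flatten-rest (d ⊕ e)       j = cong₂ _+_ (flatten-rest d j) (flatten-rest e j)
  flatten-rest (scale q _ d) j = cong (q *_) (flatten-rest d j)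

  flatten-bound : ∀ d → bound (derived (flatten d)) ≡ bound (derived d)
  flatten-bound (axiom _)     = refl
  flatten-bound (d ⊕ e)       = cong₂ _+_ (flatten-bound d) (flatten-bound e)
  flatten-bound (scale q _ d) = cong (q *_) (flatten-bound d)

  lift-refutation : Refutation row′ → Refutation row
  lift-refutation (d , d≡0 , d<0) =
    flatten d ,
    (λ { zero → flatten-lead d ; (suc j) → trans (flatten-rest d j) (d≡0 j) }) ,
    subst (_< 0ℚ) (sym (flatten-bound d)) d<0

farkas : ∀ {N} {A : Set} (row : A → Ineq N) (L : List A) →
         (∃[ x ] All (λ a → x ⊨ row a) L) ⊎ Refutation row
farkas {zero} row L with all? (λ a → 0ℚ ≤? bound (row a)) L
... | yes bounds≥0 = inj₁ ((λ ()) , bounds≥0)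
... | no ¬bounds≥0 =
  let a , b≱0 = satisfied (¬All⇒Any¬ (λ a → 0ℚ ≤? bound (row a)) L ¬bounds≥0)
  in inj₂ (axiom a , (λ ()) , ≰⇒> b≱0)
farkas {suc N} row L = Sum.map (extend L) lift-refutation (farkas row′ (eliminate L))
  where open Elimination row

-- Fractional triangle packings and covers

module _ {n m : ℕ} (D : Digraph n m) where

  rotate : ∀ {a b c} → IsTriangle D a b c → IsTriangle D b c a
  rotate (ab , bc , ca , ta≢tb , tb≢tc , ta≢tc) =
    bc , ca , ab , tb≢tc , ta≢tc ∘ sym , ta≢tb ∘ sym

  arcs-distinct : ∀ {a b c} → IsTriangle D a b c → a ≢ b × b ≢ c × a ≢ c
  arcs-distinct (_ , _ , _ , ta≢tb , tb≢tc , ta≢tc) =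
    ta≢tb ∘ cong (tail D) , tb≢tc ∘ cong (tail D) , ta≢tc ∘ cong (tail D)

  rep? : ∀ a b c → Dec (IsTriangleRep D a b c)
  rep? a b c =
    ((head D a ≟ tail D b) ×-dec (head D b ≟ tail D c) ×-dec (head D c ≟ tail D a) ×-dec
     ¬? (tail D a ≟ tail D b) ×-dec ¬? (tail D b ≟ tail D c) ×-dec ¬? (tail D a ≟ tail D c))
    ×-dec (a Finₚ.<? b) ×-dec (a Finₚ.<? c)

  some-rotation-is-rep : ∀ {a b c} → IsTriangle D a b c →
                         IsTriangleRep D a b c ⊎ IsTriangleRep D b c a ⊎ IsTriangleRep D c a b
  some-rotation-is-rep {a} {b} {c} t with arcs-distinct t | Finₚ.<-cmp a b
  ... | a≢b , _ , _ | tri≈ _ a≡b _ = contradiction a≡b a≢b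
  ... | _ , _ , a≢c | tri< a<b _ _ with Finₚ.<-cmp a c
  ...   | tri< a<c _ _ = inj₁ (t , a<b , a<c)
  ...   | tri≈ _ a≡c _ = contradiction a≡c a≢c
  ...   | tri> _ _ c<a = inj₂ (inj₂ (rotate (rotate t) , c<a , Finₚ.<-trans c<a a<b))
  some-rotation-is-rep {a} {b} {c} t | _ , b≢c , _ | tri> _ _ b<a with Finₚ.<-cmp b c
  ...   | tri< b<c _ _ = inj₂ (inj₁ (rotate t , b<c , b<a))
  ...   | tri≈ _ b≡c _ = contradiction b≡c b≢c
  ...   | tri> _ _ c<b = inj₂ (inj₂ (rotate (rotate t) , Finₚ.<-trans c<b b<a , c<b))

  covers-from-reps : (x : Vector ℚ m) →
                     (∀ {a b c} → IsTriangleRep D a b c → 1ℚ ≤ x a + x b + x c) →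
                     ∀ a b c → IsTriangle D a b c → 1ℚ ≤ x a + x b + x c
  covers-from-reps x covered a b c t with some-rotation-is-rep t
  ... | inj₁ r        = covered r
  ... | inj₂ (inj₁ r) = subst (1ℚ ≤_) (+-rotate (x b) (x c) (x a)) (covered r)
  ... | inj₂ (inj₂ r) = subst (1ℚ ≤_) (sym (+-rotate (x a) (x b) (x c))) (covered r)

record Weighting {n m : ℕ} (D : Digraph n m) : Set where
  field
    weight  : Weights m
    nonneg  : ∀ a b c → 0ℚ ≤ weight a b c
    support : ∀ a b c → ¬ IsTriangleRep D a b c → weight a b c ≡ 0ℚ

open Weighting

module _ {n m : ℕ} {D : Digraph n m} where

  zeroᵂ : Weighting D
  zeroᵂ = record
    { weight = λ _ _ _ → 0ℚ ; nonneg = λ _ _ _ → ≤-refl ; support = λ _ _ _ _ → refl }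

  _+ᵂ_ : Weighting D → Weighting D → Weighting D
  Y +ᵂ Z = record
    { weight  = λ a b c → weight Y a b c + weight Z a b c
    ; nonneg  = λ a b c → +-mono-≤ {0ℚ} {_} {0ℚ} (nonneg Y a b c) (nonneg Z a b c)
    ; support = λ a b c ¬r → cong₂ _+_ (support Y a b c ¬r) (support Z a b c ¬r)
    }

  scaleᵂ : (t : ℚ) → 0ℚ ≤ t → Weighting D → Weighting D
  scaleᵂ t t≥0 Y = record
    { weight  = λ a b c → t * weight Y a b c
    ; nonneg  = λ a b c → *-nonneg t≥0 (nonneg Y a b c)
    ; support = λ a b c ¬r → trans (cong (t *_) (support Y a b c ¬r)) (*-zeroʳ t)
    }

  pointᵂ : ∀ a b c → IsTriangleRep D a b c → Weighting D
  pointᵂ a b c r = record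
    { weight  = point a b c
    ; nonneg  = λ a′ b′ c′ →
        when-nonneg (does ((a′ , b′ , c′) ≟³ (a , b , c))) (<⇒≤ (positive⁻¹ 1ℚ))
    ; support = λ a′ b′ c′ ¬r′ → point-off {a = a} {b} {c} {a′} {b′} {c′} λ { refl → ¬r′ r }
    }

  toPacking : (Y : Weighting D) → (∀ e → load (weight Y) e ≤ w D e) → Packing D
  toPacking Y fits = record
    { mass        = weight Y
    ; mass-nonneg = nonneg Y
    ; mass-supp   = support Y
    ; capacity    = λ e →
        subst (_≤ w D e) (sym (ΣFin³≡Σ³ m λ a b c → when (memb e a b c) (weight Y a b c))) (fits e)
    }

  packingWeight-toPacking : ∀ Y fits → packingWeight (toPacking Y fits) ≡ Σ³ (weight Y)
  packingWeight-toPacking Y fits = ΣFin³≡Σ³ m (weight Y)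

  load-mass≤w : (P : Packing D) → ∀ e → load (mass P) e ≤ w D e
  load-mass≤w P e =
    subst (_≤ w D e) (ΣFin³≡Σ³ m λ a b c → when (memb e a b c) (mass P a b c)) (capacity P e)

  mass-≤-charge : (P : Packing D) {c : Vector ℚ m} → IsCover D c → ∀ a b d →
                  mass P a b d ≤ sum (λ e → c e * when (memb e a b d) (mass P a b d))
  mass-≤-charge P {c} (c-bounds , covered) a b d with rep? D a b d
  ... | no ¬r =
    subst (_≤ sum (λ e → c e * when (memb e a b d) (mass P a b d))) (sym (mass-supp P a b d ¬r))
          (sum-nonneg λ e →
             *-nonneg (proj₁ (c-bounds e)) (when-nonneg (memb e a b d) (mass-nonneg P a b d)))
  ... | yes (t , _) = begin
    M                                          ≡⟨ sym (*-identityˡ M) ⟩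
    1ℚ * M                                     ≤⟨ *-monoʳ-≤-≥0 (mass-nonneg P a b d) (covered a b d t) ⟩
    (c a + c b + c d) * M                      ≡⟨ distrib (c a) (c b) (c d) M ⟩
    c a * M + c b * M + c d * M                ≡⟨ sym (sum-memb a≢b b≢d a≢d (λ e → c e * M)) ⟩
    sum (λ e → when (memb e a b d) (c e * M))  ≡⟨ sum-cong-≗ (λ e → when-*ˡ (memb e a b d) (c e) M) ⟩
    sum (λ e → c e * when (memb e a b d) M)    ∎
    where
    open ≤-Reasoning
    M = mass P a b d
    a≢b = proj₁ (arcs-distinct D t)
    b≢d = proj₁ (proj₂ (arcs-distinct D t))
    a≢d = proj₂ (proj₂ (arcs-distinct D t))
    distrib : ∀ p q r s → (p + q + r) * s ≡ p * s + q * s + r * s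
    distrib = solve-∀ ℚ-ring

  packingWeight-≤-coverWeight : (P : Packing D) {c : Vector ℚ m} → IsCover D c →
                                packingWeight P ≤ coverWeight D c
  packingWeight-≤-coverWeight P {c} c-cover@(c-bounds , _) = begin
    packingWeight P
      ≡⟨ ΣFin³≡Σ³ m M ⟩
    Σ³ M
      ≤⟨ Σ³-mono-≤ (mass-≤-charge P c-cover) ⟩
    Σ³ (λ a b d → sum λ e → c e * when (memb e a b d) (M a b d))
      ≡⟨ Σ³-comm-sum (λ a b d e → c e * when (memb e a b d) (M a b d)) ⟩
    sum (λ e → Σ³ λ a b d → c e * when (memb e a b d) (M a b d))
      ≡⟨ sum-cong-≗ (λ e → sym (*-distribˡ-Σ³ (c e) λ a b d → when (memb e a b d) (M a b d))) ⟩
    sum (λ e → c e * load M e)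
      ≤⟨ sum-mono-≤ (λ e → *-monoˡ-≤-≥0 (proj₁ (c-bounds e)) (load-mass≤w P e)) ⟩
    sum (λ e → c e * w D e)
      ≡⟨ sum-cong-≗ (λ e → *-comm (c e) (w D e)) ⟩
    sum (λ e → w D e * c e)
      ≡⟨ sym (ΣFin≡sum m λ e → w D e * c e) ⟩
    coverWeight D c ∎
    where
    open ≤-Reasoning
    M = mass P

ν*-≤-coverWeight : ∀ {n m} {D : Digraph n m} {c v} → IsNuStar D v → IsCover D c →
                   v ≤ coverWeight D c
ν*-≤-coverWeight ((P , P≡v) , _) c-cover =
  subst (_≤ _) P≡v (packingWeight-≤-coverWeight P c-cover)

-- LP duality

module CoverSystem {n m : ℕ} (D : Digraph n m) (v : ℚ) where

  data Constraint : Set where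
    triangle    : ∀ a b c → IsTriangleRep D a b c → Constraint
    nonnegative : Fin m → Constraint
    budget      : Constraint

  system : Constraint → Ineq m
  system (triangle a b c _) = record { coeff = λ j → when (memb j a b c) (- 1ℚ) ; bound = - 1ℚ }
  system (nonnegative e)    = record { coeff = λ j → when (does (j ≟ e)) (- 1ℚ) ; bound = 0ℚ }
  system budget             = record { coeff = w D ; bound = v }

  triangles : Fin m → Fin m → Fin m → List Constraint
  triangles a b c with rep? D a b c
  ... | yes r = triangle a b c r ∷ []
  ... | no _  = []

  triangleConstraints : List Constraint
  triangleConstraints =
    concatMap (λ a → concatMap (λ b → concatMap (triangles a b) (allFin m)) (allFin m)) (allFin m)

  constraints : List Constraint
  constraints = triangleConstraints ++ map nonnegative (allFin m) ++ budget ∷ []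

  ∈-triangles : ∀ {a b c} → IsTriangleRep D a b c → ∃[ r ] triangle a b c r ∈ triangles a b c
  ∈-triangles {a} {b} {c} r with rep? D a b c
  ... | yes r′ = r′ , here refl
  ... | no ¬r  = contradiction r ¬r

  ∈-triangle : ∀ {a b c} → IsTriangleRep D a b c → ∃[ r ] triangle a b c r ∈ constraints
  ∈-triangle {a} {b} {c} r =
    proj₁ (∈-triangles r) ,
    ∈-++⁺ˡ (∈-concatMap⁺ _ (lose (∈-allFin a) (∈-concatMap⁺ _ (lose (∈-allFin b)
           (∈-concatMap⁺ _ (lose (∈-allFin c) (proj₂ (∈-triangles r))))))))

  ∈-nonnegative : ∀ e → nonnegative e ∈ constraints
  ∈-nonnegative e = ∈-++⁺ʳ triangleConstraints (∈-++⁺ˡ (∈-map⁺ nonnegative (∈-allFin e)))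

  ∈-budget : budget ∈ constraints
  ∈-budget = ∈-++⁺ʳ triangleConstraints (∈-++⁺ʳ (map nonnegative (allFin m)) (here refl))

  module Feasible (x : Vector ℚ m) (sat : All (λ k → x ⊨ system k) constraints) where

    triangle-covered : ∀ {a b c} → IsTriangleRep D a b c → 1ℚ ≤ x a + x b + x c
    triangle-covered {a} {b} {c} r@(t , _) = -1*p≤-q⇒q≤p (begin
      - 1ℚ * (x a + x b + x c)
        ≡⟨ distrib (- 1ℚ) (x a) (x b) (x c) ⟩
      - 1ℚ * x a + - 1ℚ * x b + - 1ℚ * x c
        ≡⟨ sym (sum-memb a≢b b≢c a≢c λ j → - 1ℚ * x j) ⟩
      sum (λ j → when (memb j a b c) (- 1ℚ * x j))
        ≡⟨ sym (dot-when (λ j → memb j a b c) (- 1ℚ) x) ⟩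
      dot (λ j → when (memb j a b c) (- 1ℚ)) x
        ≤⟨ All.lookup sat (proj₂ (∈-triangle r)) ⟩
      - 1ℚ ∎)
      where
      open ≤-Reasoning
      a≢b = proj₁ (arcs-distinct D t)
      b≢c = proj₁ (proj₂ (arcs-distinct D t))
      a≢c = proj₂ (proj₂ (arcs-distinct D t))
      distrib : ∀ q p r s → q * (p + r + s) ≡ q * p + q * r + q * s
      distrib = solve-∀ ℚ-ring

    x≥0 : ∀ e → 0ℚ ≤ x e
    x≥0 e = -1*p≤-q⇒q≤p (begin
      - 1ℚ * x e
        ≡⟨ sym (sum-when-≟ e λ j → - 1ℚ * x j) ⟩
      sum (λ j → when (does (j ≟ e)) (- 1ℚ * x j))
        ≡⟨ sym (dot-when (λ j → does (j ≟ e)) (- 1ℚ) x) ⟩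
      dot (λ j → when (does (j ≟ e)) (- 1ℚ)) x
        ≤⟨ All.lookup sat (∈-nonnegative e) ⟩
      0ℚ ∎)
      where open ≤-Reasoning

    clip : Vector ℚ m
    clip e = x e ⊓ 1ℚ

    clip-cover : IsCover D clip
    clip-cover =
      (λ e → ⊓1-nonneg (x≥0 e) , p⊓q≤q (x e) 1ℚ) ,
      covers-from-reps D clip λ {a} {b} {c} r →
        ⊓1-sum (x≥0 a) (x≥0 b) (x≥0 c) (triangle-covered r)

    clip-weight : coverWeight D clip ≤ v
    clip-weight = begin
      coverWeight D clip          ≡⟨ ΣFin≡sum m (λ e → w D e * clip e) ⟩
      sum (λ e → w D e * clip e)  ≤⟨ sum-mono-≤ (λ e → *-monoˡ-≤-≥0 (w-nonneg D e) (p⊓q≤p (x e) 1ℚ)) ⟩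
      dot (w D) x                 ≤⟨ All.lookup sat ∈-budget ⟩
      v                           ∎
      where open ≤-Reasoning

  -- A combination d read as a dual solution: Y collects the multipliers of the triangle
  -- constraints and Λ that of the budget; those of x ≥ 0 only lower coefficients, whence load≤.
  record Multipliers (d : Combination system) : Set where
    field
      Y     : Weighting D
      Λ     : ℚ
      Λ≥0   : 0ℚ ≤ Λ
      load≤ : ∀ e → load (weight Y) e + coeff (derived d) e ≤ Λ * w D e
      value : Λ * v - bound (derived d) ≤ Σ³ (weight Y)

  axiom-multipliers : ∀ k → Multipliers (axiom k)
  axiom-multipliers (triangle a b c r) = record
    { Y     = pointᵂ a b c r
    ; Λ     = 0ℚ
    ; Λ≥0   = ≤-refl
    ; load≤ = λ e → ≤-reflexive (begin
        load (point a b c) e + when (memb e a b c) (- 1ℚ)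
          ≡⟨ cong (_+ when (memb e a b c) (- 1ℚ)) (load-point a b c e) ⟩
        when (memb e a b c) 1ℚ + when (memb e a b c) (- 1ℚ)
          ≡⟨ sym (when-+ (memb e a b c) 1ℚ (- 1ℚ)) ⟩
        when (memb e a b c) 0ℚ
          ≡⟨ trans (when-zero (memb e a b c)) (sym (*-zeroˡ (w D e))) ⟩
        0ℚ * w D e ∎)
    ; value = ≤-reflexive (trans (0*v--1≡1 v) (sym (Σ³-point-self a b c)))
    }
    where
    open ≡-Reasoning
    0*v--1≡1 : ∀ v → 0ℚ * v - - 1ℚ ≡ 1ℚ
    0*v--1≡1 = solve-∀ ℚ-ring
  axiom-multipliers (nonnegative f) = record
    { Y     = zeroᵂ
    ; Λ     = 0ℚ
    ; Λ≥0   = ≤-refl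
    ; load≤ = λ e → begin
        load (λ _ _ _ → 0ℚ) e + when (does (e ≟ f)) (- 1ℚ)
          ≡⟨ trans (cong (_+ when (does (e ≟ f)) (- 1ℚ)) (load-zero e)) (+-identityˡ _) ⟩
        when (does (e ≟ f)) (- 1ℚ)
          ≤⟨ when-nonpos (does (e ≟ f)) (<⇒≤ (negative⁻¹ (- 1ℚ))) ⟩
        0ℚ
          ≡⟨ sym (*-zeroˡ (w D e)) ⟩
        0ℚ * w D e ∎
    ; value = ≤-reflexive (trans (0*v-0≡0 v) (sym (Σ³-0 {m})))
    }
    where
    open ≤-Reasoning
    0*v-0≡0 : ∀ v → 0ℚ * v - 0ℚ ≡ 0ℚ
    0*v-0≡0 = solve-∀ ℚ-ring
  axiom-multipliers budget = record
    { Y     = zeroᵂ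
    ; Λ     = 1ℚ
    ; Λ≥0   = <⇒≤ (positive⁻¹ 1ℚ)
    ; load≤ = λ e → ≤-reflexive (trans (cong (_+ w D e) (load-zero e)) (0+p≡1*p (w D e)))
    ; value = ≤-reflexive (trans (1*v-v≡0 v) (sym (Σ³-0 {m})))
    }
    where
    0+p≡1*p : ∀ p → 0ℚ + p ≡ 1ℚ * p
    0+p≡1*p = solve-∀ ℚ-ring
    1*v-v≡0 : ∀ v → 1ℚ * v - v ≡ 0ℚ
    1*v-v≡0 = solve-∀ ℚ-ring

  ⊕-multipliers : ∀ {d₁ d₂} → Multipliers d₁ → Multipliers d₂ → Multipliers (d₁ ⊕ d₂)
  ⊕-multipliers {d₁} {d₂} M₁ M₂ = record
    { Y     = Y M₁ +ᵂ Y M₂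
    ; Λ     = Λ M₁ + Λ M₂
    ; Λ≥0   = +-mono-≤ {0ℚ} {_} {0ℚ} (Λ≥0 M₁) (Λ≥0 M₂)
    ; load≤ = λ e → begin
        load (λ a b c → Y₁ a b c + Y₂ a b c) e + (c₁ e + c₂ e)
          ≡⟨ cong (_+ (c₁ e + c₂ e)) (load-+ Y₁ Y₂ e) ⟩
        load Y₁ e + load Y₂ e + (c₁ e + c₂ e)
          ≡⟨ interchange (load Y₁ e) (load Y₂ e) (c₁ e) (c₂ e) ⟩
        (load Y₁ e + c₁ e) + (load Y₂ e + c₂ e)
          ≤⟨ +-mono-≤ (load≤ M₁ e) (load≤ M₂ e) ⟩
        Λ M₁ * w D e + Λ M₂ * w D e
          ≡⟨ sym (*-distribʳ-+ (w D e) (Λ M₁) (Λ M₂)) ⟩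
        (Λ M₁ + Λ M₂) * w D e ∎
    ; value = begin
        (Λ M₁ + Λ M₂) * v - (b₁ + b₂)          ≡⟨ regroup (Λ M₁) (Λ M₂) v b₁ b₂ ⟩
        (Λ M₁ * v - b₁) + (Λ M₂ * v - b₂)      ≤⟨ +-mono-≤ (value M₁) (value M₂) ⟩
        Σ³ Y₁ + Σ³ Y₂                          ≡⟨ sym (Σ³-distrib-+ Y₁ Y₂) ⟩
        Σ³ (weight (Y M₁ +ᵂ Y M₂))             ∎
    }
    where
    open ≤-Reasoning
    open Multipliers
    Y₁ = weight (Y M₁)
    Y₂ = weight (Y M₂)
    c₁ = coeff (derived d₁)
    c₂ = coeff (derived d₂)
    b₁ = bound (derived d₁)
    b₂ = bound (derived d₂)
    interchange : ∀ p q r s → p + q + (r + s) ≡ (p + r) + (q + s)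
    interchange = solve-∀ ℚ-ring
    regroup : ∀ l₁ l₂ v b₁ b₂ →
              (l₁ + l₂) * v - (b₁ + b₂) ≡ (l₁ * v - b₁) + (l₂ * v - b₂)
    regroup = solve-∀ ℚ-ring

  scale-multipliers : ∀ {d} q (q≥0 : 0ℚ ≤ q) → Multipliers d → Multipliers (scale q q≥0 d)
  scale-multipliers {d} q q≥0 M = record
    { Y     = scaleᵂ q q≥0 (Y M)
    ; Λ     = q * Λ M
    ; Λ≥0   = *-nonneg q≥0 (Λ≥0 M)
    ; load≤ = λ e → begin
        load (λ a b c → q * Y′ a b c) e + q * c′ e  ≡⟨ cong (_+ q * c′ e) (load-scale q Y′ e) ⟩
        q * load Y′ e + q * c′ e                    ≡⟨ sym (*-distribˡ-+ q (load Y′ e) (c′ e)) ⟩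
        q * (load Y′ e + c′ e)                      ≤⟨ *-monoˡ-≤-≥0 q≥0 (load≤ M e) ⟩
        q * (Λ M * w D e)                           ≡⟨ sym (*-assoc q (Λ M) (w D e)) ⟩
        q * Λ M * w D e                             ∎
    ; value = begin
        q * Λ M * v - q * b′      ≡⟨ factor q (Λ M) v b′ ⟩
        q * (Λ M * v - b′)        ≤⟨ *-monoˡ-≤-≥0 q≥0 (value M) ⟩
        q * Σ³ Y′                 ≡⟨ *-distribˡ-Σ³ q Y′ ⟩
        Σ³ (weight (scaleᵂ q q≥0 (Y M))) ∎
    }
    where
    open ≤-Reasoning
    open Multipliers
    Y′ = weight (Y M)
    c′ = coeff (derived d)
    b′ = bound (derived d)
    factor : ∀ q l v b → q * l * v - q * b ≡ q * (l * v - b)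
    factor = solve-∀ ℚ-ring

  multipliers : (d : Combination system) → Multipliers d
  multipliers (axiom k)       = axiom-multipliers k
  multipliers (d₁ ⊕ d₂)       = ⊕-multipliers (multipliers d₁) (multipliers d₂)
  multipliers (scale q q≥0 d) = scale-multipliers q q≥0 (multipliers d)

  module _ (maximal : ∀ (P : Packing D) → packingWeight P ≤ v) where

    v≥0 : 0ℚ ≤ v
    v≥0 = subst (_≤ v) (trans (packingWeight-toPacking {D = D} zeroᵂ fits) (Σ³-0 {m}))
                (maximal (toPacking zeroᵂ fits))
      where
      fits : ∀ e → load (λ _ _ _ → 0ℚ) e ≤ w D e
      fits e = subst (_≤ w D e) (sym (load-zero e)) (w-nonneg D e)

    overweight : (Y : Weighting D) (Λ s t : ℚ) → 0ℚ ≤ t → t * Λ ≤ 1ℚ →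
                 (∀ e → load (weight Y) e ≤ Λ * w D e) → s ≤ Σ³ (weight Y) → ¬ v < t * s
    overweight Y Λ s t t≥0 tΛ≤1 load≤ s≤Y v<ts = <⇒≱ v<ts (begin
      t * s                         ≤⟨ *-monoˡ-≤-≥0 t≥0 s≤Y ⟩
      t * Σ³ (weight Y)             ≡⟨ *-distribˡ-Σ³ t (weight Y) ⟩
      Σ³ (weight (scaleᵂ t t≥0 Y))  ≡⟨ sym (packingWeight-toPacking (scaleᵂ t t≥0 Y) fits) ⟩
      packingWeight P               ≤⟨ maximal P ⟩
      v                             ∎)
      where
      open ≤-Reasoning
      fits : ∀ e → load (weight (scaleᵂ t t≥0 Y)) e ≤ w D e
      fits e = begin
        load (λ a b c → t * weight Y a b c) e  ≡⟨ load-scale t (weight Y) e ⟩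
        t * load (weight Y) e                  ≤⟨ *-monoˡ-≤-≥0 t≥0 (load≤ e) ⟩
        t * (Λ * w D e)                        ≡⟨ sym (*-assoc t Λ (w D e)) ⟩
        t * Λ * w D e                          ≤⟨ *-monoʳ-≤-≥0 (w-nonneg D e) tΛ≤1 ⟩
        1ℚ * w D e                             ≡⟨ *-identityˡ (w D e) ⟩
        w D e                                  ∎
      P = toPacking (scaleᵂ t t≥0 Y) fits

    -- Y scaled by 1/Λ, or by (v + 1)/(-b) when Λ = 0, would be a packing heavier than v.
    no-dual-certificate : (Y : Weighting D) (Λ b : ℚ) → 0ℚ ≤ Λ → b < 0ℚ →
                          (∀ e → load (weight Y) e ≤ Λ * w D e) →
                          Λ * v - b ≤ Σ³ (weight Y) → ⊥
    no-dual-certificate Y Λ b Λ≥0 b<0 load≤ value with <-cmp 0ℚ Λ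
    ... | tri< 0<Λ _ _ =
      overweight Y Λ (Λ * v - b) (inv⁺ Λ 0<Λ) (<⇒≤ (inv⁺-pos 0<Λ)) (≤-reflexive (inv⁺-inverseˡ 0<Λ))
                 load≤ value (v<Λ⁻¹*[Λ*v-b] v 0<Λ b<0)
    ... | tri≈ _ refl _ =
      overweight Y 0ℚ (0ℚ * v - b) t t≥0 (subst (_≤ 1ℚ) (sym (*-zeroʳ t)) (<⇒≤ (positive⁻¹ 1ℚ)))
                 load≤ value (v<[v+1]*[-b]⁻¹*[0*v-b] v b<0)
      where
      0<-b = neg-antimono-< b<0
      t = (v + 1ℚ) * inv⁺ (- b) 0<-b
      t≥0 = *-nonneg (+-mono-≤ v≥0 (<⇒≤ (positive⁻¹ 1ℚ))) (<⇒≤ (inv⁺-pos 0<-b))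
    ... | tri> _ _ Λ<0 = <⇒≱ Λ<0 Λ≥0

    no-refutation : ¬ Refutation system
    no-refutation (d , coeff≡0 , bound<0) =
      no-dual-certificate Y Λ (bound (derived d)) Λ≥0 bound<0 load≤′ value
      where
      open Multipliers (multipliers d)
      load≤′ : ∀ e → load (weight Y) e ≤ Λ * w D e
      load≤′ e = subst (_≤ Λ * w D e) (trans (cong (load (weight Y) e +_) (coeff≡0 e)) (+-identityʳ _))
                       (load≤ e)

    cover-within-budget : ∃[ x ] IsCover D x × coverWeight D x ≤ v
    cover-within-budget with farkas system constraints
    ... | inj₁ (x , sat)  = clip , clip-cover , clip-weight where open Feasible x sat
    ... | inj₂ refutation = ⊥-elim (no-refutation refutation)

optimalCover-≤-ν* : ∀ {n m} {D : Digraph n m} {c v} → IsOptimalCover D c → IsNuStar D v →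
                    coverWeight D c ≤ v
optimalCover-≤-ν* {D = D} {v = v} (_ , optimal) (_ , maximal) =
  let x , x-cover , x≤v = CoverSystem.cover-within-budget D v maximal
  in ≤-trans (optimal x x-cover) x≤v

-- Deleting an arc

punchIn-or-pivot : ∀ {k} (i j : Fin (suc k)) → i ≡ j ⊎ ∃[ j′ ] punchIn i j′ ≡ j
punchIn-or-pivot i j with i ≟ j
... | yes i≡j = inj₁ i≡j
... | no i≢j  = inj₂ (punchOut i≢j , Finₚ.punchIn-punchOut i≢j)

module _ {n k : ℕ} (D : Digraph n (suc k)) (e : Fin (suc k)) where

  cover-removeArc : ∀ {c} → IsCover D c → IsCover (removeArc D e) (c ∘ punchIn e)
  cover-removeArc (bounded , covered) =
    bounded ∘ punchIn e , λ a b d → covered (punchIn e a) (punchIn e b) (punchIn e d)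

  coverWeight-removeArc : ∀ c →
    coverWeight D c ≡ w D e * c e + coverWeight (removeArc D e) (c ∘ punchIn e)
  coverWeight-removeArc c = ΣFin-punchIn k e (λ j → w D j * c j)

  hits-insertAt : ∀ {F} → HitsAllTriangles (removeArc D e) F → HitsAllTriangles D (insertAt F e true)
  hits-insertAt {F} hits a b d t with punchIn-or-pivot e a | punchIn-or-pivot e b | punchIn-or-pivot e d
  ... | inj₁ e≡a | _        | _        = e , insertAt-lookup F e true , inj₁ e≡a
  ... | inj₂ _   | inj₁ e≡b | _        = e , insertAt-lookup F e true , inj₂ (inj₁ e≡b)
  ... | inj₂ _   | inj₂ _   | inj₁ e≡d = e , insertAt-lookup F e true , inj₂ (inj₂ e≡d)
  ... | inj₂ (a′ , refl) | inj₂ (b′ , refl) | inj₂ (d′ , refl) =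
    let f , Ff , f∈abd = hits a′ b′ d′ t
    in punchIn e f , trans (insertAt-punchIn F e true f) Ff ,
       Sum.map (cong (punchIn e)) (Sum.map (cong (punchIn e)) (cong (punchIn e))) f∈abd

  weightSet-insertAt : ∀ F → weightSet D (insertAt F e true) ≡ w D e + weightSet (removeArc D e) F
  weightSet-insertAt F =
    trans (ΣFin-punchIn k e (λ j → when (insertAt F e true j) (w D j)))
          (cong₂ _+_ (cong (λ b → when b (w D e)) (insertAt-lookup F e true))
                     (ΣFin-cong k λ j →
                        cong (λ b → when b (w D (punchIn e j))) (insertAt-punchIn F e true j)))

  τ-removeArc : ∀ {t t′} → IsTau D t → IsTau (removeArc D e) t′ → t ≤ w D e + t′
  τ-removeArc {t} (_ , minimal) ((F , hits , F≡t′) , _) =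
    subst (t ≤_) (trans (weightSet-insertAt F) (cong (w D e +_) F≡t′)) (minimal _ (hits-insertAt hits))

lemma4 : ∀ {n k : ℕ} (D : Digraph n (suc k)) (c : Fin (suc k) → ℚ) →
    IsOptimalCover D c →
    (e : Fin (suc k)) → fiveNinths ≤ c e →
    (Σ ℚ λ t' → Σ ℚ λ v' →
      IsTau (removeArc D e) t' × IsNuStar (removeArc D e) v' × (t' ≤ onePointEight * v')) →
    ∀ (t v : ℚ) → IsTau D t → IsNuStar D v → t ≤ onePointEight * v
lemma4 D c c-optimal@(c-cover , _) e 5/9≤ce (t′ , v′ , τ′ , ν′ , t′≤) t v τ ν = begin
  t                                          ≤⟨ τ-removeArc D e τ τ′ ⟩
  w D e + t′                                 ≤⟨ +-monoʳ-≤ (w D e) t′≤ ⟩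
  w D e + onePointEight * v′                 ≤⟨ +-monoʳ-≤ (w D e) (*-monoˡ-≤-nonNeg _ ν′≤C′) ⟩
  w D e + onePointEight * C′                 ≡⟨ rescale (w D e) C′ ⟩
  onePointEight * (w D e * fiveNinths + C′)  ≤⟨ *-monoˡ-≤-nonNeg _ within-budget ⟩
  onePointEight * v                          ∎
  where
  open ≤-Reasoning
  C′ = coverWeight (removeArc D e) (c ∘ punchIn e)
  ν′≤C′ : v′ ≤ C′
  ν′≤C′ = ν*-≤-coverWeight ν′ (cover-removeArc D e c-cover)
  within-budget : w D e * fiveNinths + C′ ≤ v
  within-budget = begin
    w D e * fiveNinths + C′  ≤⟨ +-monoˡ-≤ C′ (*-monoˡ-≤-≥0 (w-nonneg D e) 5/9≤ce) ⟩
    w D e * c e + C′         ≡⟨ sym (coverWeight-removeArc D e c) ⟩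
    coverWeight D c          ≤⟨ optimalCover-≤-ν* c-optimal ν ⟩
    v                        ∎
  distrib : ∀ p q x y → p * (x * q + y) ≡ x * (p * q) + p * y
  distrib = solve-∀ ℚ-ring
  -- onePointEight * fiveNinths reduces to 1ℚ, so the right-hand side of distrib is x * 1ℚ + ….
  rescale : ∀ x y → x + onePointEight * y ≡ onePointEight * (x * fiveNinths + y)
  rescale x y = trans (cong (_+ onePointEight * y) (sym (*-identityʳ x)))
                      (sym (distrib onePointEight fiveNinths x y))
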